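{- Let $n$ and $k$ be positive integers. The equation $(k!)^{n!}+k^n=(n!)^{k!}+n^k$ holds if and only if $k=n$. -}

module Defs where

{-# OPTIONS --safe #-}
-- Let a = n! and b = k! with 2 ≤ n < k. Then b = m·a with m = k!/n! ≥ k, and once
-- m ≥ 4 the bound 2ma ≤ a^m gives (n!)^(k!) = (a^m)^a ≥ (2b)^a = 2^a b^a > 2 b^a, which
-- dominates (k!)^(n!) + k^n because k^n ≤ b^a. Only (n, k) = (2, 3) escapes k ≥ 4 and is
-- settled by computation; for n = 1 the right-hand side is just 2.
module Submission where

open import Defs
open import Data.Nat using (ℕ; _+_; _^_; _≥_; _!)
open import Relation.Binary.PropositionalEquality using (_≡_)
open import Function.Bundles using (_⇔_)

open import Data.Nat using (zero; suc; _*_; _≤_; _<_; _≤′_; z≤n; s≤s; ≤′-refl; ≤′-step; NonZero)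
open import Data.Nat.Properties
open import Data.Nat.Divisibility using (m≤n⇒m!∣n!; quotient; quotient≢0; m∣n⇒n≡quotient*m)
open import Algebra.Properties.CommutativeSemigroup *-commutativeSemigroup using (x∙yz≈y∙xz)
open import Data.Product using (∃-syntax; _×_; _,_)
open import Relation.Nullary using (contradiction)
open import Relation.Binary.Definitions using (tri<; tri≈; tri>)
open import Relation.Binary.PropositionalEquality using (_≢_; refl; sym; cong; cong₂; module ≡-Reasoning)
open import Function.Bundles using (mk⇔)

n≤n! : ∀ n → n ≤ n !
n≤n! zero    = z≤n
n≤n! (suc n) = m≤m*n (suc n) (n !) {{n !≢0}}

m<n⇒n!≡o*m! : ∀ {m n} → m < n → ∃[ o ] n ! ≡ o * m ! × n ≤ o
m<n⇒n!≡o*m! {m} {suc n} (s≤s m≤n) = suc n * q , [1+n]!≡[1+n]*q*m! , m≤m*n (suc n) q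
  where
  m!∣n! = m≤n⇒m!∣n! m≤n
  q = quotient m!∣n!
  instance
    q≢0 : NonZero q
    q≢0 = quotient≢0 m!∣n! {{n !≢0}}
  [1+n]!≡[1+n]*q*m! : suc n * n ! ≡ suc n * q * m !
  [1+n]!≡[1+n]*q*m! = begin
    suc n * n !          ≡⟨ cong (suc n *_) (m∣n⇒n≡quotient*m m!∣n!) ⟩
    suc n * (q * m !)    ≡⟨ *-assoc (suc n) q (m !) ⟨
    suc n * q * m !      ∎
    where open ≡-Reasoning

^-distribʳ-* : ∀ m n o → (m * n) ^ o ≡ m ^ o * n ^ o
^-distribʳ-* m n zero    = refl
^-distribʳ-* m n (suc o) = begin
  m * n * (m * n) ^ o         ≡⟨ cong (m * n *_) (^-distribʳ-* m n o) ⟩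
  m * n * (m ^ o * n ^ o)     ≡⟨ [m*n]*[o*p]≡[m*o]*[n*p] m n (m ^ o) (n ^ o) ⟩
  m * m ^ o * (n * n ^ o)     ∎
  where open ≡-Reasoning

2*[1+n]≤2^n : ∀ {n} → 3 ≤′ n → 2 * suc n ≤ 2 ^ n
2*[1+n]≤2^n ≤′-refl = ≤-refl
2*[1+n]≤2^n {suc n} (≤′-step 3≤n) = begin
  2 * suc (suc n)          ≡⟨ *-distribˡ-+ 2 1 (suc n) ⟩
  2 + 2 * suc n            ≤⟨ +-monoˡ-≤ (2 * suc n) (m≤m*n 2 (suc n)) ⟩
  2 * suc n + 2 * suc n    ≤⟨ +-mono-≤ ih ih ⟩
  2 ^ n + 2 ^ n            ≡⟨ cong (2 ^ n +_) (+-identityʳ (2 ^ n)) ⟨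
  2 ^ suc n                ∎
  where
  open ≤-Reasoning
  ih = 2*[1+n]≤2^n 3≤n

2*[m*a]≤a^m : ∀ {a m} → 2 ≤ a → 4 ≤ m → 2 * (m * a) ≤ a ^ m
2*[m*a]≤a^m {a} {suc m} 2≤a (s≤s 3≤m) = begin
  2 * (suc m * a)    ≡⟨ cong (2 *_) (*-comm (suc m) a) ⟩
  2 * (a * suc m)    ≡⟨ x∙yz≈y∙xz 2 a (suc m) ⟩
  a * (2 * suc m)    ≤⟨ *-monoʳ-≤ a (2*[1+n]≤2^n (≤⇒≤′ 3≤m)) ⟩
  a * 2 ^ m          ≤⟨ *-monoʳ-≤ a (^-monoˡ-≤ m 2≤a) ⟩
  a * a ^ m          ∎
  where open ≤-Reasoning

2*[m*a]^a<a^[m*a] : ∀ {a m} → 2 ≤ a → 4 ≤ m → 2 * (m * a) ^ a < a ^ (m * a)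
2*[m*a]^a<a^[m*a] {a@(suc _)} {m@(suc _)} 2≤a 4≤m = begin-strict
  2 * b ^ a        <⟨ *-monoˡ-< (b ^ a) {{m^n≢0 b a}} (n≤1+n 3) ⟩
  2 ^ 2 * b ^ a    ≤⟨ *-monoˡ-≤ (b ^ a) (^-monoʳ-≤ 2 2≤a) ⟩
  2 ^ a * b ^ a    ≡⟨ ^-distribʳ-* 2 b a ⟨
  (2 * b) ^ a      ≤⟨ ^-monoˡ-≤ a (2*[m*a]≤a^m 2≤a 4≤m) ⟩
  (a ^ m) ^ a      ≡⟨ ^-*-assoc a m a ⟩
  a ^ (m * a)      ∎
  where
  open ≤-Reasoning
  b = m * a

k^n≤k!^n! : ∀ n k → k ^ n ≤ (k !) ^ (n !)
k^n≤k!^n! n k = ≤-trans (^-monoˡ-≤ n (n≤n! k)) (^-monoʳ-≤ (k !) {{k !≢0}} (n≤n! n))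

F : ℕ → ℕ → ℕ
F n k = (k !) ^ (n !) + k ^ n

F[k,1]<F[1,k] : ∀ {k} → 1 < k → F k 1 < F 1 k
F[k,1]<F[1,k] {k} 1<k = begin-strict
  F k 1      ≡⟨ cong₂ _+_ (^-zeroˡ (k !)) (^-zeroˡ k) ⟩
  1 + 1      <⟨ +-mono-≤-< (1≤n! k) 1<k ⟩
  k ! + k    ≡⟨ cong₂ _+_ (^-identityʳ (k !)) (^-identityʳ k) ⟨
  F 1 k      ∎
  where open ≤-Reasoning

F[n,k]<F[k,n] : ∀ {n k} → 2 ≤ n → n < k → 4 ≤ k → F n k < F k n
F[n,k]<F[k,n] {n} {k} 2≤n n<k 4≤k with m<n⇒n!≡o*m! n<k
... | m , k!≡m*n! , k≤m = begin-strict
  (k !) ^ (n !) + k ^ n               ≤⟨ +-monoʳ-≤ ((k !) ^ (n !)) (k^n≤k!^n! n k) ⟩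
  (k !) ^ (n !) + (k !) ^ (n !)       ≡⟨ cong ((k !) ^ (n !) +_) (+-identityʳ ((k !) ^ (n !))) ⟨
  2 * (k !) ^ (n !)                   ≡⟨ cong (λ b → 2 * b ^ (n !)) k!≡m*n! ⟩
  2 * (m * n !) ^ (n !)               <⟨ 2*[m*a]^a<a^[m*a] (≤-trans 2≤n (n≤n! n)) (≤-trans 4≤k k≤m) ⟩
  (n !) ^ (m * n !)                   ≡⟨ cong ((n !) ^_) k!≡m*n! ⟨
  (n !) ^ (k !)                       ≤⟨ m≤m+n ((n !) ^ (k !)) (n ^ k) ⟩
  F k n                               ∎
  where open ≤-Reasoning

F[n,k]≢F[k,n] : ∀ {n k} → 1 ≤ n → n < k → F n k ≢ F k n
F[n,k]≢F[k,n] {1}                 _ 1<k = >⇒≢ (F[k,1]<F[1,k] 1<k)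
F[n,k]≢F[k,n] {2}               {3} _ _ = λ ()  -- 45 ≢ 72
F[n,k]≢F[k,n] {suc (suc _)}     {suc (suc (suc (suc _)))} _ n<k =
  <⇒≢ (F[n,k]<F[k,n] (s≤s (s≤s z≤n)) n<k (s≤s (s≤s (s≤s (s≤s z≤n)))))
F[n,k]≢F[k,n] {suc (suc _)}       {1} _ (s≤s ())
F[n,k]≢F[k,n] {suc (suc _)}       {2} _ (s≤s (s≤s ()))
F[n,k]≢F[k,n] {suc (suc (suc _))} {3} _ (s≤s (s≤s (s≤s ())))

theorem1p2 : (n k : ℕ) → n ≥ 1 → k ≥ 1 →
    (((k !) ^ (n !) + k ^ n ≡ (n !) ^ (k !) + n ^ k) ⇔ (k ≡ n))
theorem1p2 n k n≥1 k≥1 = mk⇔ F[n,k]≡F[k,n]⇒k≡n (λ { refl → refl })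
  where
  F[n,k]≡F[k,n]⇒k≡n : F n k ≡ F k n → k ≡ n
  F[n,k]≡F[k,n]⇒k≡n e with <-cmp n k
  ... | tri< n<k _ _ = contradiction e (F[n,k]≢F[k,n] n≥1 n<k)
  ... | tri≈ _ n≡k _ = sym n≡k
  ... | tri> _ _ k<n = contradiction (sym e) (F[n,k]≢F[k,n] k≥1 k<n)
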